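{- For every $n\ge0$, $$\#\mathrm{Av}_n([1234],[1243],[1423])=\#\mathrm{Av}_n([1234],[1342],[1423])=\#\mathrm{Av}_n([1243],[1324],[1432])=\#\mathrm{Av}_n([1324],[1342],[1432]).$$ Moreover, for $n\ge2$, $\#\mathrm{Av}_n([1234],[1342],[1423])=n-1$.
   Context: For a linear permutation $\pi=\pi_1\ldots\pi_n$ of $[n]$, the cyclic permutation $[\pi]$ is the set of all rotations of $\pi$. A linear permutation $\sigma$ contains $\pi$ if some subsequence of $\sigma$ is order isomorphic to $\pi$ (same relative order). A cyclic permutation $[\sigma]$ contains $[\pi]$ if some rotation of $\sigma$ contains $\pi$; otherwise it avoids $[\pi]$. For a set of cyclic patterns $[\Pi]$, $\mathrm{Av}_n[\Pi]$ denotes the set of cyclic permutations of length $n$ avoiding every pattern in $[\Pi]$. -}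

module Defs where

open import Data.Nat using (ℕ; suc; _<_)
open import Data.List using (List; []; _∷_; length; map; upTo; zip; drop; take; _++_)
open import Data.List.Membership.Propositional using (_∈_)
open import Data.List.Relation.Unary.All using (All)
open import Data.List.Relation.Unary.Any using (Any)
open import Data.List.Relation.Unary.AllPairs using (AllPairs)
open import Data.List.Relation.Binary.Sublist.Propositional using (_⊆_)
open import Data.List.Relation.Binary.Permutation.Propositional using (_↭_)
open import Data.Product using (_×_; ∃; ∃-syntax; proj₁; proj₂)
open import Function.Bundles using (_⇔_)
open import Relation.Binary.PropositionalEquality using (_≡_)
open import Relation.Nullary using (¬_)

IsPerm : ℕ → List ℕ → Set
IsPerm n σ = σ ↭ map suc (upTo n)

-- Order isomorphism: same length, and for any two positions the
-- relative order of the entries agrees (comparing all pairs of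
-- position-aligned entries; with trichotomy this also forces equal ⇔ equal).
OrderIso : List ℕ → List ℕ → Set
OrderIso τ π = (length τ ≡ length π) ×
  (∀ p q → p ∈ zip τ π → q ∈ zip τ π → (proj₁ p < proj₁ q ⇔ proj₂ p < proj₂ q))

Contains : List ℕ → List ℕ → Set
Contains σ π = ∃[ τ ] (τ ⊆ σ × OrderIso τ π)

rotate : ℕ → List ℕ → List ℕ
rotate k σ = drop k σ ++ take k σ

CycContains : List ℕ → List ℕ → Set
CycContains σ π = ∃[ k ] Contains (rotate k σ) π

AvoidsAll : List (List ℕ) → List ℕ → Set
AvoidsAll Π σ = All (λ π → ¬ CycContains σ π) Π

SameCyc : List ℕ → List ℕ → Set
SameCyc σ τ = ∃[ k ] τ ≡ rotate k σ

-- I.e. c is the number of rotation classes in Av_n[Π].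
NumAv : List (List ℕ) → ℕ → ℕ → Set
NumAv Π n c = ∃[ L ] ((length L ≡ c)
  × All (IsPerm n) L
  × All (AvoidsAll Π) L
  × AllPairs (λ σ τ → ¬ SameCyc σ τ) L
  × (∀ σ → IsPerm n σ → AvoidsAll Π σ → Any (λ τ → SameCyc τ σ) L))

p1234 p1243 p1423 p1342 p1324 p1432 : List ℕ
p1234 = 1 ∷ 2 ∷ 3 ∷ 4 ∷ []
p1243 = 1 ∷ 2 ∷ 4 ∷ 3 ∷ []
p1423 = 1 ∷ 4 ∷ 2 ∷ 3 ∷ []
p1342 = 1 ∷ 3 ∷ 4 ∷ 2 ∷ []
p1324 = 1 ∷ 3 ∷ 2 ∷ 4 ∷ []
p1432 = 1 ∷ 4 ∷ 3 ∷ 2 ∷ []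

-- Rotate a cyclic permutation of [n] so that an extreme entry e comes first: e = n for the first and
-- last pattern sets, e = 1 for the other two. Ranking values by R, where R is < or >, each pattern of
-- the set, read cyclically from its entry n (resp. 1), is e followed by a triple in order 132, 213 or
-- 321. Hence an avoider is e ∷ r where r has no such triple, and a duplicate-free list without such
-- triples is a rotation of a sorted list; so r is a rotation of the R-sorted list s of the remaining
-- values. Conversely each of the n − 1 lists e ∷ rotate j s avoids the set: up to relabelling, their
-- 4-element subsequences have finitely many shapes, which are checked by computation.
module Submission where

open import Defs
open import Data.Bool using (T)
open import Data.Empty using (⊥-elim)
open import Data.List
  using (List; []; _∷_; [_]; _++_; length; map; drop; take; head; zip; upTo; applyUpTo; applyDownFrom)
open import Data.List.Properties
  using (∷-injective; ++-assoc; ++-identityʳ; take++drop≡id; length-++; length-map; map-++; length-upTo; map-upTo;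
         applyUpTo-∷ʳ; length-applyUpTo; length-applyDownFrom; reverse-applyUpTo)
open import Data.List.Membership.Propositional using (_∈_; find; lose)
open import Data.List.Membership.Propositional.Properties
  using (∈-map⁺; ∈-upTo⁺; ∈-++⁺ˡ; ∈-++⁺ʳ; ∈-∃++; ∈-applyUpTo⁻; ∈-applyDownFrom⁻)
open import Data.List.Relation.Unary.All as All using (All; []; _∷_)
import Data.List.Relation.Unary.All.Properties as All
open import Data.List.Relation.Unary.Any as Any using (Any; here; there)
open import Data.List.Relation.Unary.AllPairs as AllPairs using (AllPairs; []; _∷_)
import Data.List.Relation.Unary.AllPairs.Properties as AllPairs
open import Data.List.Relation.Unary.Unique.Propositional using (Unique)
open import Data.List.Relation.Binary.Sublist.Propositional using (_⊆_; []; _∷_; _∷ʳ_; from∈; lookup)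
open import Data.List.Relation.Binary.Sublist.Propositional.Properties using (++⁺; All-resp-⊆; length-mono-≤)
open import Data.List.Relation.Binary.Permutation.Propositional
  using (_↭_; ↭-refl; ↭-sym; ↭-trans; ↭-reflexive; prep; ↭⇒↭ₛ)
open import Data.List.Relation.Binary.Permutation.Propositional.Properties
  using (++-comm; ∷↭∷ʳ; ↭-reverse; ↭-empty-inv; ↭-singleton-inv; ∈-resp-↭; ↭-length; drop-∷)
open import Data.Maybe using (just)
open import Data.Maybe.Properties using (just-injective)
open import Data.Nat using (ℕ; zero; suc; _<_; _≤_; _>_; _∸_; s≤s; z≤n; _<ᵇ_; _<?_; _≤?_; _≟_)
open import Data.Nat.Properties
  using (<-isStrictTotalOrder; <⇒<ᵇ; <-cmp; <-irrefl; <-asym; <-trans; ≤⇒≯; ≤-refl; m≤m+n; m<m+n; suc-injective)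
open import Data.List.Membership.DecPropositional _≟_ using (_∈?_)
open import Data.Product using (_×_; _,_; proj₁; proj₂; map₁; ∃-syntax; ∃₂)
open import Data.Sum using (_⊎_; inj₁; inj₂)
open import Function using (_∘_; id)
open import Function.Bundles using (_⇔_; mk⇔; Equivalence)
import Function.Properties.Equivalence as ⇔
open import Level using (0ℓ)
open import Relation.Binary using (Rel; IsStrictTotalOrder; tri<; tri≈; tri>)
import Relation.Binary.Construct.Flip.EqAndOrd as Flip
open import Relation.Binary.PropositionalEquality
  using (_≡_; _≢_; refl; sym; trans; cong; cong₂; subst; subst₂; setoid; module ≡-Reasoning)
open import Data.List.Relation.Binary.Permutation.Setoid.Properties (setoid ℕ) using (Unique-resp-↭)
open import Relation.Nullary using (¬_; Dec)
open import Relation.Nullary.Decidable using (_×-dec_; _⊎-dec_; ¬?; toWitness; True)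

private variable
  A : Set
  σ ρ ρ' τ τ' : List A

-- Rotations

Rotation : List A → List A → Set
Rotation σ ρ = ∃₂ λ x y → σ ≡ x ++ y × ρ ≡ y ++ x

rotation-refl : ∀ (σ : List A) → Rotation σ σ
rotation-refl σ = [] , σ , refl , sym (++-identityʳ σ)

rotation-sym : Rotation σ ρ → Rotation ρ σ
rotation-sym (x , y , σ≡ , ρ≡) = y , x , ρ≡ , σ≡

++-≡-++ : ∀ (x y u v : List A) → x ++ y ≡ u ++ v →
  (∃[ w ] u ≡ x ++ w × y ≡ w ++ v) ⊎ (∃[ w ] x ≡ u ++ w × v ≡ w ++ y)
++-≡-++ [] y u v eq = inj₁ (u , refl , eq)
++-≡-++ (a ∷ x) y [] v eq = inj₂ (a ∷ x , refl , sym eq)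
++-≡-++ (a ∷ x) y (b ∷ u) v eq with ∷-injective eq
... | refl , eq' with ++-≡-++ x y u v eq'
... | inj₁ (w , p , q) = inj₁ (w , cong (a ∷_) p , q)
... | inj₂ (w , p , q) = inj₂ (w , cong (a ∷_) p , q)

rotation-trans : Rotation σ ρ → Rotation ρ ρ' → Rotation σ ρ'
rotation-trans (x , y , refl , refl) (u , v , eq , refl) with ++-≡-++ y x u v eq
... | inj₁ (w , refl , refl) = w , v ++ y , ++-assoc w v y , sym (++-assoc v y w)
... | inj₂ (w , refl , refl) = x ++ u , w , sym (++-assoc x u w) , ++-assoc w x u

rotation-↭ : Rotation σ ρ → ρ ↭ σ
rotation-↭ (x , y , refl , refl) = ++-comm y x

rotation-length : Rotation σ ρ → length ρ ≡ length σ
rotation-length = ↭-length ∘ rotation-↭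

rotation-++ : ∀ (x y : List A) → Rotation (x ++ y) (y ++ x)
rotation-++ x y = x , y , refl , refl

drop-length-++ : ∀ (x y : List A) → drop (length x) (x ++ y) ≡ y
drop-length-++ [] y = refl
drop-length-++ (a ∷ x) y = drop-length-++ x y

take-length-++ : ∀ (x y : List A) → take (length x) (x ++ y) ≡ x
take-length-++ [] y = refl
take-length-++ (a ∷ x) y = cong (a ∷_) (take-length-++ x y)

rotate-++ : ∀ (x y : List ℕ) → rotate (length x) (x ++ y) ≡ y ++ x
rotate-++ x y = cong₂ _++_ (drop-length-++ x y) (take-length-++ x y)

rotation-rotate : ∀ k (σ : List ℕ) → Rotation σ (rotate k σ)
rotation-rotate k σ = take k σ , drop k σ , sym (take++drop≡id k σ) , refl

rotation⇒sameCyc : ∀ {σ ρ : List ℕ} → Rotation σ ρ → SameCyc σ ρ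
rotation⇒sameCyc (x , y , refl , refl) = length x , sym (rotate-++ x y)

sameCyc⇒rotation : ∀ {σ ρ : List ℕ} → SameCyc σ ρ → Rotation σ ρ
sameCyc⇒rotation {σ} (k , refl) = rotation-rotate k σ

rotation-to-front : ∀ {e : A} {σ} → e ∈ σ → ∃[ r ] Rotation σ (e ∷ r)
rotation-to-front e∈σ with ∈-∃++ e∈σ
... | x , y , σ≡ = y ++ x , x , _ ∷ y , σ≡ , refl

rotations : List ℕ → List (List ℕ)
rotations κ = map (λ i → rotate i κ) (upTo (suc (length κ)))

rotation∈rotations : ∀ {κ κ' : List ℕ} → Rotation κ κ' → κ' ∈ rotations κ
rotation∈rotations (x , y , refl , refl) =
  subst (_∈ rotations (x ++ y)) (rotate-++ x y) (∈-map⁺ (λ i → rotate i (x ++ y)) (∈-upTo⁺ (s≤s x≤x++y)))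
  where
  x≤x++y : length x ≤ length (x ++ y)
  x≤x++y = subst (length x ≤_) (sym (length-++ x)) (m≤m+n (length x) (length y))

map-≡-++ : ∀ {B : Set} (f : A → B) κ (x y : List B) → map f κ ≡ x ++ y →
  ∃₂ λ κx κy → κ ≡ κx ++ κy × x ≡ map f κx × y ≡ map f κy
map-≡-++ f κ [] y eq = [] , κ , refl , refl , sym eq
map-≡-++ f (k ∷ κ) (a ∷ x) y eq with ∷-injective eq
... | refl , eq' with map-≡-++ f κ x y eq'
... | κx , κy , refl , refl , refl = k ∷ κx , κy , refl , refl , refl

rotation-map : ∀ {B : Set} (f : A → B) κ {τ} → Rotation (map f κ) τ → ∃[ κ' ] Rotation κ κ' × τ ≡ map f κ'
rotation-map f κ (x , y , eq , refl) with map-≡-++ f κ x y eq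
... | κx , κy , refl , refl , refl = κy ++ κx , (κx , κy , refl , refl) , sym (map-++ f κy κx)

⊆-++⁻ : ∀ (x y : List A) → τ ⊆ x ++ y → ∃₂ λ t u → τ ≡ t ++ u × t ⊆ x × u ⊆ y
⊆-++⁻ [] y p = [] , _ , refl , [] , p
⊆-++⁻ (a ∷ x) y (.a ∷ʳ p) with ⊆-++⁻ x y p
... | t , u , e , p₁ , p₂ = t , u , e , a ∷ʳ p₁ , p₂
⊆-++⁻ (a ∷ x) y (eq ∷ p) with ⊆-++⁻ x y p
... | t , u , refl , p₁ , p₂ = _ , u , refl , eq ∷ p₁ , p₂

++-⊆⁻ : ∀ (t u : List A) → t ++ u ⊆ σ → ∃₂ λ x y → σ ≡ x ++ y × t ⊆ x × u ⊆ y
++-⊆⁻ [] u p = [] , _ , refl , [] , p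
++-⊆⁻ (a ∷ t) u (b ∷ʳ p) with ++-⊆⁻ (a ∷ t) u p
... | x , y , refl , p₁ , p₂ = b ∷ x , y , refl , b ∷ʳ p₁ , p₂
++-⊆⁻ (a ∷ t) u (eq ∷ p) with ++-⊆⁻ t u p
... | x , y , refl , p₁ , p₂ = _ ∷ x , y , refl , eq ∷ p₁ , p₂

⊆-rotation : τ ⊆ ρ → Rotation τ τ' → ∃[ ρ' ] Rotation ρ ρ' × τ' ⊆ ρ'
⊆-rotation p (t , u , refl , refl) with ++-⊆⁻ t u p
... | x , y , eq , p₁ , p₂ = y ++ x , (x , y , eq , refl) , ++⁺ p₂ p₁

rotation-⊆ : Rotation σ ρ → τ ⊆ ρ → ∃[ τ₀ ] τ₀ ⊆ σ × Rotation τ₀ τ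
rotation-⊆ (x , y , refl , refl) p with ⊆-++⁻ y x p
... | t , u , refl , p₁ , p₂ = u ++ t , ++⁺ p₂ p₁ , (u , t , refl , refl)

subsequence-rotation⇒cycContains : ∀ {σ τ τ' π : List ℕ} → τ ⊆ σ → Rotation τ τ' → OrderIso τ' π →
  CycContains σ π
subsequence-rotation⇒cycContains {τ' = τ'} p r iso with ⊆-rotation p r
... | ρ , r' , p' with rotation⇒sameCyc r'
... | k , refl = k , τ' , p' , iso

cycContains⇒subsequence-rotation : ∀ {σ π : List ℕ} → CycContains σ π →
  ∃₂ λ τ τ' → τ ⊆ σ × Rotation τ τ' × OrderIso τ' π
cycContains⇒subsequence-rotation {σ} (k , τ' , p , iso) with rotation-⊆ (rotation-rotate k σ) p
... | τ , p' , r = τ , τ' , p' , r , iso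

cycContains-rotation : ∀ {σ ρ π : List ℕ} → Rotation σ ρ → CycContains ρ π → CycContains σ π
cycContains-rotation r c with cycContains⇒subsequence-rotation c
... | τ , τ' , p , r' , iso with rotation-⊆ r p
... | τ₀ , p₀ , r₀ = subsequence-rotation⇒cycContains p₀ (rotation-trans r₀ r') iso

avoidsAll-rotation : ∀ {Π σ ρ} → Rotation σ ρ → AvoidsAll Π σ → AvoidsAll Π ρ
avoidsAll-rotation rot = All.map (λ σ-avoids ρ-contains → σ-avoids (cycContains-rotation rot ρ-contains))

-- Order isomorphisms

[1…4] : List ℕ
[1…4] = 1 ∷ 2 ∷ 3 ∷ 4 ∷ []

[4…1] : List ℕ
[4…1] = 4 ∷ 3 ∷ 2 ∷ 1 ∷ []

StrictMonoOn : List ℕ → (ℕ → ℕ) → Set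
StrictMonoOn D f = ∀ {x y} → x ∈ D → y ∈ D → x < y → f x < f y

strictMonoOn-restrict : ∀ {D κ f} → All (_∈ D) κ → StrictMonoOn D f → StrictMonoOn κ f
strictMonoOn-restrict κ⊆D mono x∈κ y∈κ = mono (All.lookup κ⊆D x∈κ) (All.lookup κ⊆D y∈κ)

strictMonoOn-⇔ : ∀ {D f x y} → StrictMonoOn D f → x ∈ D → y ∈ D → (f x < f y ⇔ x < y)
strictMonoOn-⇔ {f = f} {x} {y} mono x∈D y∈D = mk⇔ reflect (mono x∈D y∈D)
  where
  reflect : f x < f y → x < y
  reflect fx<fy with <-cmp x y
  ... | tri< x<y _ _ = x<y
  ... | tri≈ _ refl _ = ⊥-elim (<-irrefl refl fx<fy)
  ... | tri> _ _ y<x = ⊥-elim (<-asym fx<fy (mono y∈D x∈D y<x))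

strictMonoOn-↭ : ∀ {D D' f} → D' ↭ D → StrictMonoOn D f → StrictMonoOn D' f
strictMonoOn-↭ D'↭D mono x∈ y∈ = mono (∈-resp-↭ D'↭D x∈) (∈-resp-↭ D'↭D y∈)

∈-zip⁻ˡ : ∀ {B : Set} (κ : List A) (π : List B) {p} → p ∈ zip κ π → proj₁ p ∈ κ
∈-zip⁻ˡ (k ∷ κ) (x ∷ π) (here refl) = here refl
∈-zip⁻ˡ (k ∷ κ) (x ∷ π) (there m) = there (∈-zip⁻ˡ κ π m)

∈-zip-mapˡ : ∀ {B C : Set} (f : A → C) (κ : List A) (π : List B) {p} →
  p ∈ zip κ π → map₁ f p ∈ zip (map f κ) π
∈-zip-mapˡ f (k ∷ κ) (x ∷ π) (here refl) = here refl
∈-zip-mapˡ f (k ∷ κ) (x ∷ π) (there m) = there (∈-zip-mapˡ f κ π m)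

∈-zip-map-self : ∀ {B : Set} (f : A → B) (π : List A) {p} → p ∈ zip (map f π) π → ∃[ x ] x ∈ π × p ≡ (f x , x)
∈-zip-map-self f (x ∷ π) (here refl) = x , here refl , refl
∈-zip-map-self f (x ∷ π) (there m) with ∈-zip-map-self f π m
... | y , y∈π , refl = y , there y∈π , refl

map-orderIso : ∀ {f} π → StrictMonoOn π f → OrderIso (map f π) π
map-orderIso {f} π mono = length-map f π , agree
  where
  agree : ∀ p q → p ∈ zip (map f π) π → q ∈ zip (map f π) π → (proj₁ p < proj₁ q ⇔ proj₂ p < proj₂ q)
  agree p q p∈ q∈ with ∈-zip-map-self f π p∈ | ∈-zip-map-self f π q∈
  ... | x , x∈π , refl | y , y∈π , refl = strictMonoOn-⇔ mono x∈π y∈π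

map-orderIso⁻ : ∀ {f} κ π → StrictMonoOn κ f → OrderIso (map f κ) π → OrderIso κ π
map-orderIso⁻ {f} κ π mono (length≡ , agree) = trans (sym (length-map f κ)) length≡ , agree'
  where
  agree' : ∀ p q → p ∈ zip κ π → q ∈ zip κ π → (proj₁ p < proj₁ q ⇔ proj₂ p < proj₂ q)
  agree' p q p∈ q∈ = ⇔.trans (⇔.sym (strictMonoOn-⇔ mono (∈-zip⁻ˡ κ π p∈) (∈-zip⁻ˡ κ π q∈)))
                             (agree _ _ (∈-zip-mapˡ f κ π p∈) (∈-zip-mapˡ f κ π q∈))

Discordant : ℕ × ℕ → ℕ × ℕ → Set
Discordant (a , b) (c , d) = (a < c × ¬ b < d) ⊎ (¬ a < c × b < d)

discordant? : ∀ p q → Dec (Discordant p q)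
discordant? (a , b) (c , d) = (a <? c ×-dec ¬? (b <? d)) ⊎-dec (¬? (a <? c) ×-dec b <? d)

discordant⇒¬⇔ : ∀ {p q} → Discordant p q → ¬ (proj₁ p < proj₁ q ⇔ proj₂ p < proj₂ q)
discordant⇒¬⇔ (inj₁ (a<c , b≮d)) a<c⇔b<d = b≮d (Equivalence.to a<c⇔b<d a<c)
discordant⇒¬⇔ (inj₂ (a≮c , b<d)) a<c⇔b<d = a≮c (Equivalence.from a<c⇔b<d b<d)

Discordance : List ℕ → List ℕ → Set
Discordance κ π = Any (λ p → Any (Discordant p) (zip κ π)) (zip κ π)

discordance? : ∀ κ π → Dec (Discordance κ π)
discordance? κ π = Any.any? (λ p → Any.any? (discordant? p) (zip κ π)) (zip κ π)

discordance⇒¬orderIso : ∀ {κ π} → Discordance κ π → ¬ OrderIso κ π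
discordance⇒¬orderIso d (_ , agree) with find d
... | p , p∈ , d' with find d'
... | q , q∈ , p⋈q = discordant⇒¬⇔ p⋈q (agree p q p∈ q∈)

relabel : ℕ → ℕ → ℕ → ℕ → ℕ → ℕ
relabel a b c d 1 = a
relabel a b c d 2 = b
relabel a b c d 3 = c
relabel a b c d _ = d

relabel-strictMono : ∀ {a b c d} → a < b → b < c → c < d → StrictMonoOn [1…4] (relabel a b c d)
relabel-strictMono a<b b<c c<d x∈ y∈ x<y = go x∈ y∈ (<⇒<ᵇ x<y)
  where
  go : ∀ {x y} → x ∈ [1…4] → y ∈ [1…4] → T (x <ᵇ y) → relabel _ _ _ _ x < relabel _ _ _ _ y
  go (here refl) (there (here refl)) _ = a<b
  go (here refl) (there (there (here refl))) _ = <-trans a<b b<c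
  go (here refl) (there (there (there (here refl)))) _ = <-trans a<b (<-trans b<c c<d)
  go (there (here refl)) (there (there (here refl))) _ = b<c
  go (there (here refl)) (there (there (there (here refl)))) _ = <-trans b<c c<d
  go (there (there (here refl))) (there (there (there (here refl)))) _ = c<d
  go (here refl) (here refl) ()
  go (there (here refl)) (here refl) ()
  go (there (here refl)) (there (here refl)) ()
  go (there (there (here refl))) (here refl) ()
  go (there (there (here refl))) (there (here refl)) ()
  go (there (there (here refl))) (there (there (here refl))) ()
  go (there (there (there (here refl)))) (here refl) ()
  go (there (there (there (here refl)))) (there (here refl)) ()
  go (there (there (there (here refl)))) (there (there (here refl))) ()
  go (there (there (there (here refl)))) (there (there (there (here refl)))) ()

relabel-strictMonoOn : ∀ {a b c d} → a < b → b < c → c < d →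
  ∀ κ → {True (All.all? (_∈? [1…4]) κ)} → StrictMonoOn κ (relabel a b c d)
relabel-strictMonoOn a<b b<c c<d κ {κ⊆[1…4]} =
  strictMonoOn-restrict (toWitness κ⊆[1…4]) (relabel-strictMono a<b b<c c<d)

relabel-orderIso : ∀ {a b c d} → a < b → b < c → c < d →
  ∀ π → {True (All.all? (_∈? [1…4]) π)} → OrderIso (map (relabel a b c d) π) π
relabel-orderIso a<b b<c c<d π {π⊆[1…4]} = map-orderIso π (relabel-strictMonoOn a<b b<c c<d π {π⊆[1…4]})

increasing-shape₄ : ∀ {t} → AllPairs _<_ t → length t ≡ 4 → ∃[ f ] StrictMonoOn [1…4] f × t ≡ map f [1…4]
increasing-shape₄ {a ∷ b ∷ c ∷ d ∷ []} ((a<b ∷ _) ∷ (b<c ∷ _) ∷ (c<d ∷ []) ∷ [] ∷ []) refl =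
  relabel a b c d , relabel-strictMono a<b b<c c<d , refl

decreasing-shape₄ : ∀ {t} → AllPairs _>_ t → length t ≡ 4 → ∃[ f ] StrictMonoOn [4…1] f × t ≡ map f [4…1]
decreasing-shape₄ {a ∷ b ∷ c ∷ d ∷ []} ((b<a ∷ _) ∷ (c<b ∷ _) ∷ (d<c ∷ []) ∷ [] ∷ []) refl =
  relabel d c b a , relabel-strictMonoOn d<c c<b b<a [4…1] , refl

RotationsDiscordant : List ℕ → List ℕ → Set
RotationsDiscordant κ π = All (λ κ' → Discordance κ' π) (rotations κ)

rotationsDiscordant? : ∀ κ π → Dec (RotationsDiscordant κ π)
rotationsDiscordant? κ π = All.all? (λ κ' → discordance? κ' π) (rotations κ)

rotationsDiscordant⇒¬orderIso : ∀ {f κ₀ κ π} → StrictMonoOn κ₀ f → Rotation κ₀ κ → RotationsDiscordant κ₀ π →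
  ¬ OrderIso (map f κ) π
rotationsDiscordant⇒¬orderIso {κ = κ} {π} mono rot discordant iso =
  discordance⇒¬orderIso (All.lookup discordant (rotation∈rotations rot))
    (map-orderIso⁻ κ π (strictMonoOn-↭ (rotation-↭ rot) mono) iso)

-- Rotations of sorted lists

AllPairs-resp-⊆ : ∀ {R : Rel A 0ℓ} {xs ys} → xs ⊆ ys → AllPairs R ys → AllPairs R xs
AllPairs-resp-⊆ [] [] = []
AllPairs-resp-⊆ (y ∷ʳ p) (_ ∷ Rys) = AllPairs-resp-⊆ p Rys
AllPairs-resp-⊆ (refl ∷ p) (Ry ∷ Rys) = All-resp-⊆ p Ry ∷ AllPairs-resp-⊆ p Rys

AllPairs-++⁻ : ∀ {R : Rel A 0ℓ} xs {ys} → AllPairs R (xs ++ ys) →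
  AllPairs R xs × AllPairs R ys × All (λ x → All (R x) ys) xs
AllPairs-++⁻ [] Rys = [] , Rys , []
AllPairs-++⁻ (x ∷ xs) (Rx ∷ Rxsys) with AllPairs-++⁻ xs Rxsys
... | Rxs , Rys , Rxsys' = All.++⁻ˡ xs Rx ∷ Rxs , Rys , All.++⁻ʳ xs Rx ∷ Rxsys'

pair-⊆-++ : ∀ {x y : A} {xs ys} → x ∈ xs → y ∈ ys → x ∷ y ∷ [] ⊆ xs ++ ys
pair-⊆-++ x∈ y∈ = ++⁺ (from∈ x∈) (from∈ y∈)

module CyclicSorting {R : Rel A 0ℓ} (sto : IsStrictTotalOrder _≡_ R) where

  open IsStrictTotalOrder sto using (compare) renaming (trans to R-trans; irrefl to R-irrefl; asym to R-asym)

  Sorted : List A → Set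
  Sorted = AllPairs R

  -- With respect to R, a b c is in one of the orders 132, 213, 321 (the rotations of 321).
  CyclicallyDecreasing : A → A → A → Set
  CyclicallyDecreasing a b c = (R a c × R c b) ⊎ (R b a × R a c) ⊎ (R c b × R b a)

  NoCyclicDescent : List A → Set
  NoCyclicDescent r = ∀ {a b c} → a ∷ b ∷ c ∷ [] ⊆ r → ¬ CyclicallyDecreasing a b c

  CyclicallySorted : List A → Set
  CyclicallySorted r = ∃₂ λ u v → r ≡ v ++ u × Sorted (u ++ v)

  sorted-↭⇒≡ : ∀ {xs ys} → Sorted xs → Sorted ys → xs ↭ ys → xs ≡ ys
  sorted-↭⇒≡ {[]} {[]} _ _ _ = refl
  sorted-↭⇒≡ {[]} {y ∷ ys} _ _ p with ↭-length p
  ... | ()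
  sorted-↭⇒≡ {x ∷ xs} {[]} _ _ p with ↭-length p
  ... | ()
  sorted-↭⇒≡ {x ∷ xs} {y ∷ ys} (Rx ∷ Rxs) (Ry ∷ Rys) p with ∈-resp-↭ p (here refl)
  ... | here refl = cong (x ∷_) (sorted-↭⇒≡ Rxs Rys (drop-∷ p))
  ... | there x∈ys with ∈-resp-↭ (↭-sym p) (here refl)
  ...   | here refl = ⊥-elim (R-irrefl refl (All.lookup Ry x∈ys))
  ...   | there y∈xs = ⊥-elim (R-asym (All.lookup Ry x∈ys) (All.lookup Rx y∈xs))

  compare-≢ : ∀ {a x} → a ≢ x → R a x ⊎ R x a
  compare-≢ {a} {x} a≢x with compare a x
  ... | tri< a<x _ _ = inj₁ a<x
  ... | tri≈ _ a≡x _ = ⊥-elim (a≢x a≡x)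
  ... | tri> _ _ x<a = inj₂ x<a

  split-around : ∀ a {r} → Sorted r → All (a ≢_) r → ∃₂ λ p q → r ≡ p ++ q × All (λ x → R x a) p × All (R a) q
  split-around a [] [] = [] , [] , refl , [] , []
  split-around a {x ∷ r} (Rx ∷ Rr) (a≢x ∷ a∉r) with compare-≢ a≢x
  ... | inj₁ a<x = [] , x ∷ r , refl , [] , a<x ∷ All.map (R-trans a<x) Rx
  ... | inj₂ x<a with split-around a Rr a∉r
  ...   | p , q , refl , p<a , a<q = x ∷ p , q , refl , x<a ∷ p<a , a<q

  cons-sorted : ∀ a {r} → Sorted r → All (a ≢_) r → NoCyclicDescent (a ∷ r) → CyclicallySorted (a ∷ r)
  cons-sorted a Rr a∉r noDescent with split-around a Rr a∉r
  ... | [] , q , refl , [] , a<q = a ∷ q , [] , refl , subst Sorted (sym (++-identityʳ (a ∷ q))) (a<q ∷ Rr)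
  ... | p , [] , refl , p<a , [] = p , a ∷ [] , cong (a ∷_) (++-identityʳ p) ,
          AllPairs.++⁺ (subst Sorted (++-identityʳ p) Rr) ([] ∷ []) (All.map (_∷ []) p<a)
  ... | b ∷ p , c ∷ q , refl , b<a ∷ _ , a<c ∷ _ =
          ⊥-elim (noDescent (refl ∷ pair-⊆-++ (here refl) (here refl)) (inj₂ (inj₁ (b<a , a<c))))

  insert-rotated : ∀ a u v → Sorted (u ++ v) → All (a ≢_) (v ++ u) → NoCyclicDescent (a ∷ v ++ u) →
    CyclicallySorted (a ∷ v ++ u)
  insert-rotated a u [] Ru a∉u noDescent = cons-sorted a (subst Sorted (++-identityʳ u) Ru) a∉u noDescent
  insert-rotated a [] v Rv a∉v noDescent with v ++ [] | ++-identityʳ v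
  ... | _ | refl = cons-sorted a Rv a∉v noDescent
  insert-rotated a (z ∷ u) (w ∷ v) Ruv a∉ noDescent with AllPairs-++⁻ (z ∷ u) Ruv
  ... | Rzu , Rwv , zu<wv = z ∷ u , a ∷ w ∷ v , refl ,
          AllPairs.++⁺ Rzu (All.tabulate a<wv ∷ Rwv) (All.tabulate λ x∈ → zu<a x∈ ∷ All.lookup zu<wv x∈)
    where
    a<wv : ∀ {x} → x ∈ w ∷ v → R a x
    a<wv {x} x∈ with compare-≢ (All.lookup a∉ (∈-++⁺ˡ x∈))
    ... | inj₁ a<x = a<x
    ... | inj₂ x<a = ⊥-elim (noDescent (refl ∷ pair-⊆-++ x∈ (here refl))
                              (inj₂ (inj₂ (All.lookup (All.lookup zu<wv (here refl)) x∈ , x<a))))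
    zu<a : ∀ {x} → x ∈ z ∷ u → R x a
    zu<a {x} x∈ with compare-≢ (All.lookup a∉ (∈-++⁺ʳ (w ∷ v) x∈))
    ... | inj₂ x<a = x<a
    ... | inj₁ a<x = ⊥-elim (noDescent (refl ∷ pair-⊆-++ (here refl) x∈)
                              (inj₁ (a<x , All.lookup (All.lookup zu<wv x∈) (here refl))))

  cyclicallySorted : ∀ {r} → Unique r → NoCyclicDescent r → CyclicallySorted r
  cyclicallySorted {[]} _ _ = [] , [] , refl , []
  cyclicallySorted {a ∷ r} (a∉r ∷ unique) noDescent with cyclicallySorted unique (noDescent ∘ (a ∷ʳ_))
  ... | u , v , refl , Ruv = insert-rotated a u v Ruv a∉r noDescent

∈-drop : ∀ j (s : List A) {y t} → drop j s ≡ y ∷ t → y ∈ s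
∈-drop zero (x ∷ s) refl = here refl
∈-drop (suc j) (x ∷ s) eq = there (∈-drop j s eq)

drop-nonempty : ∀ i (s : List A) → i < length s → ∃₂ λ x t → drop i s ≡ x ∷ t
drop-nonempty zero (x ∷ s) _ = x , s , refl
drop-nonempty (suc i) (x ∷ s) (s≤s i<len) = drop-nonempty i s i<len

drop-heads-distinct : ∀ {s : List A} i j {x y t t'} → Unique s → i < j →
  drop i s ≡ x ∷ t → drop j s ≡ y ∷ t' → x ≢ y
drop-heads-distinct {s = z ∷ s} zero (suc j) (z∉s ∷ _) _ refl eq = All.lookup z∉s (∈-drop j s eq)
drop-heads-distinct {s = z ∷ s} (suc i) (suc j) (_ ∷ unique) (s≤s i<j) = drop-heads-distinct i j unique i<j

rotate-injective : ∀ {s : List ℕ} {i j} → Unique s → i < j → j < length s → rotate i s ≢ rotate j s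
rotate-injective {s} {i} {j} unique i<j j<len eq
  with drop-nonempty i s (<-trans i<j j<len) | drop-nonempty j s j<len
... | x , t , dropᵢ | y , t' , dropⱼ = drop-heads-distinct i j unique i<j dropᵢ dropⱼ (just-injective (begin
  just x                   ≡⟨ cong (head ∘ (_++ take i s)) dropᵢ ⟨
  head (rotate i s)        ≡⟨ cong head eq ⟩
  head (rotate j s)        ≡⟨ cong (head ∘ (_++ take j s)) dropⱼ ⟩
  just y                   ∎))
  where open ≡-Reasoning

∷-rotation-cancel : ∀ {e : A} {xs ys} → All (e ≢_) xs → Rotation (e ∷ xs) (e ∷ ys) → xs ≡ ys
∷-rotation-cancel {xs = xs} _ ([] , _ , refl , refl) = sym (++-identityʳ xs)
∷-rotation-cancel _ (_ ∷ x , [] , refl , refl) = ++-identityʳ x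
∷-rotation-cancel e∉ (_ ∷ x , _ ∷ y , refl , refl) = ⊥-elim (All.lookup e∉ (∈-++⁺ʳ x (here refl)) refl)

rotation-index : ∀ (u v : List ℕ) → 0 < length (u ++ v) →
  ∃[ j ] j < length (u ++ v) × v ++ u ≡ rotate j (u ++ v)
rotation-index u [] pos = 0 , pos , trans (sym (++-identityʳ u)) (sym (++-identityʳ (u ++ [])))
rotation-index u (w ∷ v) _ = length u , u<u++wv , sym (rotate-++ u (w ∷ v))
  where
  u<u++wv : length u < length (u ++ w ∷ v)
  u<u++wv = subst (length u <_) (sym (length-++ u)) (m<m+n (length u) (s≤s z≤n))

>-isStrictTotalOrder : IsStrictTotalOrder _≡_ _>_
>-isStrictTotalOrder = Flip.isStrictTotalOrder <-isStrictTotalOrder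

applyDownFrom↭applyUpTo : ∀ (f : ℕ → A) n → applyDownFrom f n ↭ applyUpTo f n
applyDownFrom↭applyUpTo f n = subst (_↭ applyUpTo f n) (reverse-applyUpTo f n) (↭-reverse (applyUpTo f n))

max∷increasing-perm : ∀ m → IsPerm (suc m) (suc m ∷ applyUpTo suc m)
max∷increasing-perm m =
  ↭-trans (∷↭∷ʳ (suc m) (applyUpTo suc m)) (↭-reflexive (trans (applyUpTo-∷ʳ suc m) (sym (map-upTo suc (suc m)))))

min∷increasing-perm : ∀ m → IsPerm (suc m) (1 ∷ applyUpTo (suc ∘ suc) m)
min∷increasing-perm m = ↭-reflexive (sym (map-upTo suc (suc m)))

-- The candidate avoiders e ∷ rotate j s

module Candidates {R : Rel ℕ 0ℓ} (sto : IsStrictTotalOrder _≡_ R) (e : ℕ) (s : List ℕ)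
  (s-sorted : AllPairs R s) (e∉s : All (e ≢_) s) (n : ℕ) (e∷s-perm : IsPerm n (e ∷ s)) where

  open CyclicSorting sto
  open IsStrictTotalOrder sto using () renaming (irrefl to R-irrefl)

  s-unique : Unique s
  s-unique = AllPairs.map (λ x<y x≡y → R-irrefl x≡y x<y) s-sorted

  candidate : ℕ → List ℕ
  candidate j = e ∷ rotate j s

  candidates : List (List ℕ)
  candidates = map candidate (upTo (length s))

  candidates-length : length candidates ≡ length s
  candidates-length = trans (length-map candidate (upTo (length s))) (length-upTo (length s))

  candidate-perm : ∀ j → IsPerm n (candidate j)
  candidate-perm j = ↭-trans (prep e (rotation-↭ (rotation-rotate j s))) e∷s-perm

  candidates-distinct : AllPairs (λ σ τ → ¬ SameCyc σ τ) candidates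
  candidates-distinct = AllPairs.map⁺ (AllPairs.applyUpTo⁺₁ id (length s) distinct)
    where
    distinct : ∀ {i j} → i < j → j < length s → ¬ SameCyc (candidate i) (candidate j)
    distinct {i} i<j j<len same = rotate-injective s-unique i<j j<len
      (∷-rotation-cancel (All.anti-mono (∈-resp-↭ (rotation-↭ (rotation-rotate i s))) e∉s)
                         (sameCyc⇒rotation same))

  sorted-rotation : 0 < length s → ∀ {r} → r ↭ s → NoCyclicDescent r → ∃[ j ] j < length s × r ≡ rotate j s
  sorted-rotation s-nonempty r↭s noDescent
    with cyclicallySorted (Unique-resp-↭ (↭⇒↭ₛ (↭-sym r↭s)) s-unique) noDescent
  ... | u , v , refl , uv-sorted with sorted-↭⇒≡ uv-sorted s-sorted (↭-trans (++-comm u v) r↭s)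
  ... | refl = rotation-index u v s-nonempty

  DescentsForbidden : List (List ℕ) → Set
  DescentsForbidden Π = ∀ {r a b c} → a ∈ s → b ∈ s → c ∈ s → a ∷ b ∷ c ∷ [] ⊆ r → CyclicallyDecreasing a b c →
    ¬ AvoidsAll Π (e ∷ r)

  avoider-noCyclicDescent : ∀ {Π} → DescentsForbidden Π → ∀ {σ r} → AvoidsAll Π σ → Rotation σ (e ∷ r) → r ↭ s →
    NoCyclicDescent r
  avoider-noCyclicDescent forbidden σ-avoids rot r↭s abc⊆r decreasing =
    forbidden (∈s (here refl)) (∈s (there (here refl))) (∈s (there (there (here refl)))) abc⊆r decreasing
      (avoidsAll-rotation rot σ-avoids)
    where
    ∈s : ∀ {x} → x ∈ _ → x ∈ s
    ∈s x∈abc = ∈-resp-↭ r↭s (lookup abc⊆r x∈abc)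

  candidates-complete : ∀ Π → 0 < length s → DescentsForbidden Π →
    ∀ σ → IsPerm n σ → AvoidsAll Π σ → Any (λ τ → SameCyc τ σ) candidates
  candidates-complete Π s-nonempty forbidden σ σ-perm σ-avoids
    with σ↭e∷s ← ↭-trans σ-perm (↭-sym e∷s-perm)
    with r , rot ← rotation-to-front (∈-resp-↭ (↭-sym σ↭e∷s) (here refl))
    with r↭s ← drop-∷ (↭-trans (rotation-↭ rot) σ↭e∷s)
    with j , j<len , refl ← sorted-rotation s-nonempty r↭s (avoider-noCyclicDescent forbidden σ-avoids rot r↭s)
    = lose (∈-map⁺ candidate (∈-upTo⁺ j<len)) (rotation⇒sameCyc (rotation-sym rot))

  candidates-numAv : ∀ Π {k} → length s ≡ suc k → DescentsForbidden Π → (∀ j → AvoidsAll Π (candidate j)) →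
    NumAv Π n (suc k)
  candidates-numAv Π length≡ forbidden avoids =
    candidates , trans candidates-length length≡ , All.map⁺ (All.tabulate λ {j} _ → candidate-perm j) ,
    All.map⁺ (All.tabulate λ {j} _ → avoids j) , candidates-distinct ,
    candidates-complete Π (subst (0 <_) (sym length≡) (s≤s z≤n)) forbidden

  -- Up to rotation, a subsequence of e ∷ rotate j s is a subsequence t of s, possibly preceded by e.
  -- shape₃ and shape₄ present these as monotone images of fixed lists, so avoiding π is a finite check.
  module Avoidance (ke : ℕ) (κ₃ κ₄ : List ℕ)
    (shape₃ : ∀ {t} → t ⊆ s → length t ≡ 3 → ∃[ f ] StrictMonoOn (ke ∷ κ₃) f × f ke ≡ e × t ≡ map f κ₃)
    (shape₄ : ∀ {t} → t ⊆ s → length t ≡ 4 → ∃[ f ] StrictMonoOn κ₄ f × t ≡ map f κ₄) where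

    avoids-without-e : ∀ j {τ τ' π} → length π ≡ 4 → RotationsDiscordant κ₄ π →
      τ ⊆ rotate j s → Rotation τ τ' → ¬ OrderIso τ' π
    avoids-without-e j length≡4 discordant τ⊆ rot iso with rotation-⊆ (rotation-rotate j s) τ⊆
    ... | τ₀ , τ₀⊆s , rot₀
      with shape₄ τ₀⊆s (trans (sym (rotation-length (rotation-trans rot₀ rot))) (trans (proj₁ iso) length≡4))
    ... | f , mono , refl with rotation-map f κ₄ (rotation-trans rot₀ rot)
    ... | κ , rotκ , refl = rotationsDiscordant⇒¬orderIso mono rotκ discordant iso

    avoids-with-e : ∀ j {τ τ' π} → length π ≡ 4 → All (λ κ₁ → RotationsDiscordant (ke ∷ κ₁) π) (rotations κ₃) →
      τ ⊆ rotate j s → Rotation (e ∷ τ) τ' → ¬ OrderIso τ' π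
    avoids-with-e j length≡4 discordant τ⊆ rot iso with rotation-⊆ (rotation-rotate j s) τ⊆
    ... | τ₀ , τ₀⊆s , rot₀
      with shape₃ τ₀⊆s (trans (sym (rotation-length rot₀))
                              (suc-injective (trans (sym (rotation-length rot)) (trans (proj₁ iso) length≡4))))
    ... | f , mono , fke≡e , refl with rotation-map f κ₃ rot₀
    ... | κ₁ , rot₁ , refl with rotation-map f (ke ∷ κ₁) (subst (λ x → Rotation (x ∷ map f κ₁) _) (sym fke≡e) rot)
    ... | κ , rotκ , refl = rotationsDiscordant⇒¬orderIso (strictMonoOn-↭ (prep ke (rotation-↭ rot₁)) mono) rotκ
                              (All.lookup discordant (rotation∈rotations rot₁)) iso

    candidate-avoids : ∀ j π → length π ≡ 4 →
      {True (All.all? (λ κ₁ → rotationsDiscordant? (ke ∷ κ₁) π) (rotations κ₃))} →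
      {True (rotationsDiscordant? κ₄ π)} → ¬ CycContains (candidate j) π
    candidate-avoids j π length≡4 {d₃} {d₄} contains with cycContains⇒subsequence-rotation contains
    ... | _ , _ , (_ ∷ʳ τ⊆) , rot , iso = avoids-without-e j length≡4 (toWitness d₄) τ⊆ rot iso
    ... | _ , _ , (refl ∷ τ⊆) , rot , iso = avoids-with-e j length≡4 (toWitness d₃) τ⊆ rot iso

-- The four pattern sets

module MaxThenDecreasing (k : ℕ) where

  N : ℕ
  N = suc (suc k)

  s : List ℕ
  s = applyDownFrom suc (suc k)

  below : ∀ {a} → a ∈ s → a < N
  below a∈s with ∈-applyDownFrom⁻ suc a∈s
  ... | i , i<m , refl = s≤s i<m

  s-sorted : AllPairs _>_ s
  s-sorted = AllPairs.applyDownFrom⁺₁ suc (suc k) (λ j<i _ → s≤s j<i)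

  N∷s-perm : IsPerm N (N ∷ s)
  N∷s-perm = ↭-trans (prep N (applyDownFrom↭applyUpTo suc (suc k))) (max∷increasing-perm (suc k))

  open Candidates >-isStrictTotalOrder N s s-sorted (All.tabulate λ a∈s N≡a → <-irrefl (sym N≡a) (below a∈s))
         N N∷s-perm

  descentsForbidden : DescentsForbidden (p1234 ∷ p1243 ∷ p1423 ∷ [])
  descentsForbidden a∈s _ _ abc⊆r (inj₁ (c<a , b<c)) (_ ∷ ¬1243 ∷ _) =
    ¬1243 (subsequence-rotation⇒cycContains (refl ∷ abc⊆r) (rotation-++ (N ∷ _ ∷ []) _)
      (relabel-orderIso b<c c<a (below a∈s) p1243))
  descentsForbidden _ b∈s _ abc⊆r (inj₂ (inj₁ (a<b , c<a))) (_ ∷ _ ∷ ¬1423 ∷ _) =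
    ¬1423 (subsequence-rotation⇒cycContains (refl ∷ abc⊆r) (rotation-++ (N ∷ _ ∷ _ ∷ []) _)
      (relabel-orderIso c<a a<b (below b∈s) p1423))
  descentsForbidden _ _ c∈s abc⊆r (inj₂ (inj₂ (b<c , a<b))) (¬1234 ∷ _) =
    ¬1234 (subsequence-rotation⇒cycContains (refl ∷ abc⊆r) (rotation-++ [ N ] _)
      (relabel-orderIso a<b b<c (below c∈s) p1234))

  shape₃ : ∀ {t} → t ⊆ s → length t ≡ 3 → ∃[ f ] StrictMonoOn [4…1] f × f 4 ≡ N × t ≡ map f (3 ∷ 2 ∷ 1 ∷ [])
  shape₃ {a ∷ b ∷ c ∷ []} t⊆s refl with AllPairs-resp-⊆ t⊆s s-sorted
  ... | (b<a ∷ _) ∷ (c<b ∷ []) ∷ [] ∷ [] =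
    relabel c b a N , relabel-strictMonoOn c<b b<a (below (lookup t⊆s (here refl))) _ , refl , refl

  open Avoidance 4 (3 ∷ 2 ∷ 1 ∷ []) [4…1] shape₃ (λ t⊆s → decreasing-shape₄ (AllPairs-resp-⊆ t⊆s s-sorted))

  numAv : NumAv (p1234 ∷ p1243 ∷ p1423 ∷ []) N (suc k)
  numAv = candidates-numAv _ (length-applyDownFrom suc (suc k)) descentsForbidden λ j →
    candidate-avoids j p1234 refl ∷ candidate-avoids j p1243 refl ∷ candidate-avoids j p1423 refl ∷ []

module MinThenDecreasing (k : ℕ) where

  N : ℕ
  N = suc (suc k)

  s : List ℕ
  s = applyDownFrom (suc ∘ suc) (suc k)

  above : ∀ {a} → a ∈ s → 1 < a
  above a∈s with ∈-applyDownFrom⁻ (suc ∘ suc) a∈s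
  ... | _ , _ , refl = s≤s (s≤s z≤n)

  s-sorted : AllPairs _>_ s
  s-sorted = AllPairs.applyDownFrom⁺₁ (suc ∘ suc) (suc k) (λ j<i _ → s≤s (s≤s j<i))

  1∷s-perm : IsPerm N (1 ∷ s)
  1∷s-perm = ↭-trans (prep 1 (applyDownFrom↭applyUpTo (suc ∘ suc) (suc k))) (min∷increasing-perm (suc k))

  open Candidates >-isStrictTotalOrder 1 s s-sorted (All.tabulate λ a∈s 1≡a → <-irrefl 1≡a (above a∈s))
         N 1∷s-perm

  descentsForbidden : DescentsForbidden (p1234 ∷ p1342 ∷ p1423 ∷ [])
  descentsForbidden _ b∈s _ abc⊆r (inj₁ (c<a , b<c)) (_ ∷ _ ∷ ¬1423 ∷ _) =
    ¬1423 (subsequence-rotation⇒cycContains (refl ∷ abc⊆r) (rotation-refl _)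
      (relabel-orderIso (above b∈s) b<c c<a p1423))
  descentsForbidden _ _ c∈s abc⊆r (inj₂ (inj₁ (a<b , c<a))) (_ ∷ ¬1342 ∷ _) =
    ¬1342 (subsequence-rotation⇒cycContains (refl ∷ abc⊆r) (rotation-refl _)
      (relabel-orderIso (above c∈s) c<a a<b p1342))
  descentsForbidden a∈s _ _ abc⊆r (inj₂ (inj₂ (b<c , a<b))) (¬1234 ∷ _) =
    ¬1234 (subsequence-rotation⇒cycContains (refl ∷ abc⊆r) (rotation-refl _)
      (relabel-orderIso (above a∈s) a<b b<c p1234))

  shape₃ : ∀ {t} → t ⊆ s → length t ≡ 3 →
    ∃[ f ] StrictMonoOn (1 ∷ 4 ∷ 3 ∷ 2 ∷ []) f × f 1 ≡ 1 × t ≡ map f (4 ∷ 3 ∷ 2 ∷ [])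
  shape₃ {a ∷ b ∷ c ∷ []} t⊆s refl with AllPairs-resp-⊆ t⊆s s-sorted
  ... | (b<a ∷ _) ∷ (c<b ∷ []) ∷ [] ∷ [] =
    relabel 1 c b a , relabel-strictMonoOn (above (lookup t⊆s (there (there (here refl))))) c<b b<a _ , refl , refl

  open Avoidance 1 (4 ∷ 3 ∷ 2 ∷ []) [4…1] shape₃ (λ t⊆s → decreasing-shape₄ (AllPairs-resp-⊆ t⊆s s-sorted))

  numAv : NumAv (p1234 ∷ p1342 ∷ p1423 ∷ []) N (suc k)
  numAv = candidates-numAv _ (length-applyDownFrom (suc ∘ suc) (suc k)) descentsForbidden λ j →
    candidate-avoids j p1234 refl ∷ candidate-avoids j p1342 refl ∷ candidate-avoids j p1423 refl ∷ []

module MinThenIncreasing (k : ℕ) where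

  N : ℕ
  N = suc (suc k)

  s : List ℕ
  s = applyUpTo (suc ∘ suc) (suc k)

  above : ∀ {a} → a ∈ s → 1 < a
  above a∈s with ∈-applyUpTo⁻ (suc ∘ suc) a∈s
  ... | _ , _ , refl = s≤s (s≤s z≤n)

  s-sorted : AllPairs _<_ s
  s-sorted = AllPairs.applyUpTo⁺₁ (suc ∘ suc) (suc k) (λ i<j _ → s≤s (s≤s i<j))

  open Candidates <-isStrictTotalOrder 1 s s-sorted (All.tabulate λ a∈s 1≡a → <-irrefl 1≡a (above a∈s))
         N (min∷increasing-perm (suc k))

  descentsForbidden : DescentsForbidden (p1243 ∷ p1324 ∷ p1432 ∷ [])
  descentsForbidden a∈s _ _ abc⊆r (inj₁ (a<c , c<b)) (¬1243 ∷ _) =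
    ¬1243 (subsequence-rotation⇒cycContains (refl ∷ abc⊆r) (rotation-refl _)
      (relabel-orderIso (above a∈s) a<c c<b p1243))
  descentsForbidden _ b∈s _ abc⊆r (inj₂ (inj₁ (b<a , a<c))) (_ ∷ ¬1324 ∷ _) =
    ¬1324 (subsequence-rotation⇒cycContains (refl ∷ abc⊆r) (rotation-refl _)
      (relabel-orderIso (above b∈s) b<a a<c p1324))
  descentsForbidden _ _ c∈s abc⊆r (inj₂ (inj₂ (c<b , b<a))) (_ ∷ _ ∷ ¬1432 ∷ _) =
    ¬1432 (subsequence-rotation⇒cycContains (refl ∷ abc⊆r) (rotation-refl _)
      (relabel-orderIso (above c∈s) c<b b<a p1432))

  shape₃ : ∀ {t} → t ⊆ s → length t ≡ 3 → ∃[ f ] StrictMonoOn [1…4] f × f 1 ≡ 1 × t ≡ map f (2 ∷ 3 ∷ 4 ∷ [])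
  shape₃ {a ∷ b ∷ c ∷ []} t⊆s refl with AllPairs-resp-⊆ t⊆s s-sorted
  ... | (a<b ∷ _) ∷ (b<c ∷ []) ∷ [] ∷ [] =
    relabel 1 a b c , relabel-strictMono (above (lookup t⊆s (here refl))) a<b b<c , refl , refl

  open Avoidance 1 (2 ∷ 3 ∷ 4 ∷ []) [1…4] shape₃ (λ t⊆s → increasing-shape₄ (AllPairs-resp-⊆ t⊆s s-sorted))

  numAv : NumAv (p1243 ∷ p1324 ∷ p1432 ∷ []) N (suc k)
  numAv = candidates-numAv _ (length-applyUpTo (suc ∘ suc) (suc k)) descentsForbidden λ j →
    candidate-avoids j p1243 refl ∷ candidate-avoids j p1324 refl ∷ candidate-avoids j p1432 refl ∷ []

module MaxThenIncreasing (k : ℕ) where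

  N : ℕ
  N = suc (suc k)

  s : List ℕ
  s = applyUpTo suc (suc k)

  below : ∀ {a} → a ∈ s → a < N
  below a∈s with ∈-applyUpTo⁻ suc a∈s
  ... | i , i<m , refl = s≤s i<m

  s-sorted : AllPairs _<_ s
  s-sorted = AllPairs.applyUpTo⁺₁ suc (suc k) (λ i<j _ → s≤s i<j)

  open Candidates <-isStrictTotalOrder N s s-sorted (All.tabulate λ a∈s N≡a → <-irrefl (sym N≡a) (below a∈s)) N
         (max∷increasing-perm (suc k))

  descentsForbidden : DescentsForbidden (p1324 ∷ p1342 ∷ p1432 ∷ [])
  descentsForbidden _ b∈s _ abc⊆r (inj₁ (a<c , c<b)) (¬1324 ∷ _) =
    ¬1324 (subsequence-rotation⇒cycContains (refl ∷ abc⊆r) (rotation-++ [ N ] _)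
      (relabel-orderIso a<c c<b (below b∈s) p1324))
  descentsForbidden _ _ c∈s abc⊆r (inj₂ (inj₁ (b<a , a<c))) (_ ∷ ¬1342 ∷ _) =
    ¬1342 (subsequence-rotation⇒cycContains (refl ∷ abc⊆r) (rotation-++ (N ∷ _ ∷ []) _)
      (relabel-orderIso b<a a<c (below c∈s) p1342))
  descentsForbidden a∈s _ _ abc⊆r (inj₂ (inj₂ (c<b , b<a))) (_ ∷ _ ∷ ¬1432 ∷ _) =
    ¬1432 (subsequence-rotation⇒cycContains (refl ∷ abc⊆r) (rotation-++ (N ∷ _ ∷ _ ∷ []) _)
      (relabel-orderIso c<b b<a (below a∈s) p1432))

  shape₃ : ∀ {t} → t ⊆ s → length t ≡ 3 →
    ∃[ f ] StrictMonoOn (4 ∷ 1 ∷ 2 ∷ 3 ∷ []) f × f 4 ≡ N × t ≡ map f (1 ∷ 2 ∷ 3 ∷ [])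
  shape₃ {a ∷ b ∷ c ∷ []} t⊆s refl with AllPairs-resp-⊆ t⊆s s-sorted
  ... | (a<b ∷ _) ∷ (b<c ∷ []) ∷ [] ∷ [] =
    relabel a b c N , relabel-strictMonoOn a<b b<c (below (lookup t⊆s (there (there (here refl))))) _ , refl , refl

  open Avoidance 4 (1 ∷ 2 ∷ 3 ∷ []) [1…4] shape₃ (λ t⊆s → increasing-shape₄ (AllPairs-resp-⊆ t⊆s s-sorted))

  numAv : NumAv (p1324 ∷ p1342 ∷ p1432 ∷ []) N (suc k)
  numAv = candidates-numAv _ (length-applyUpTo suc (suc k)) descentsForbidden λ j →
    candidate-avoids j p1324 refl ∷ candidate-avoids j p1342 refl ∷ candidate-avoids j p1432 refl ∷ []

short-¬cycContains : ∀ {σ π : List ℕ} → length σ < length π → ¬ CycContains σ π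
short-¬cycContains {σ} σ<π (k , τ , τ⊆ , iso) =
  ≤⇒≯ (subst₂ _≤_ (proj₁ iso) (rotation-length (rotation-rotate k σ)) (length-mono-≤ τ⊆)) σ<π

numAv-singleton : ∀ Π {n} σ → IsPerm n σ → (∀ τ → IsPerm n τ → τ ≡ σ) → All (λ π → length σ < length π) Π →
  NumAv Π n 1
numAv-singleton Π σ σ-perm only-σ short =
  [ σ ] , refl , σ-perm ∷ [] , All.map short-¬cycContains short ∷ [] , [] ∷ [] ,
  λ τ τ-perm _ → here (subst (SameCyc σ) (sym (only-σ τ τ-perm)) (rotation⇒sameCyc (rotation-refl σ)))

numAv-small : ∀ Π n → n ≤ 1 → {True (All.all? (λ π → 2 ≤? length π) Π)} → NumAv Π n 1
numAv-small Π 0 _ {long} =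
  numAv-singleton Π [] ↭-refl (λ _ → ↭-empty-inv) (All.map (<-trans (s≤s z≤n)) (toWitness long))
numAv-small Π 1 _ {long} = numAv-singleton Π [ 1 ] ↭-refl (λ _ → ↭-singleton-inv) (toWitness long)
numAv-small Π (suc (suc _)) (s≤s ())

mainTheorem11 : (∀ (n : ℕ) → ∃[ c ] (NumAv (p1234 ∷ p1243 ∷ p1423 ∷ []) n c × NumAv (p1234 ∷ p1342 ∷ p1423 ∷ []) n c × NumAv (p1243 ∷ p1324 ∷ p1432 ∷ []) n c × NumAv (p1324 ∷ p1342 ∷ p1432 ∷ []) n c))
    × (∀ (n : ℕ) → 2 ≤ n → NumAv (p1234 ∷ p1342 ∷ p1423 ∷ []) n (n ∸ 1))
mainTheorem11 = equinumerous , count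
  where
  equinumerous : ∀ n → ∃[ c ] (NumAv (p1234 ∷ p1243 ∷ p1423 ∷ []) n c × NumAv (p1234 ∷ p1342 ∷ p1423 ∷ []) n c ×
                               NumAv (p1243 ∷ p1324 ∷ p1432 ∷ []) n c × NumAv (p1324 ∷ p1342 ∷ p1432 ∷ []) n c)
  equinumerous 0 = 1 , numAv-small _ 0 z≤n , numAv-small _ 0 z≤n , numAv-small _ 0 z≤n , numAv-small _ 0 z≤n
  equinumerous 1 = 1 , numAv-small _ 1 ≤-refl , numAv-small _ 1 ≤-refl , numAv-small _ 1 ≤-refl ,
                       numAv-small _ 1 ≤-refl
  equinumerous (suc (suc k)) = suc k , MaxThenDecreasing.numAv k , MinThenDecreasing.numAv k ,
                                       MinThenIncreasing.numAv k , MaxThenIncreasing.numAv k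

  count : ∀ n → 2 ≤ n → NumAv (p1234 ∷ p1342 ∷ p1423 ∷ []) n (n ∸ 1)
  count (suc (suc k)) _ = MinThenDecreasing.numAv k
  count 1 (s≤s ())
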